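{- For each real $\epsilon>0$, the simple degree sequence region $\mathbb D[\varphi_\epsilon]$ is almost fully graphic, where $\varphi_\epsilon(n,\Sigma,c_1,c_2)$ is the property "$2\le c_2$ and $3\le c_1\le\sqrt{(1-\epsilon)\Sigma}$".
   Context: For natural numbers $n>c_1\ge c_2$ and $\Sigma$, $\mathcal D(n,\Sigma,c_1,c_2)$ is the set of integer sequences $(d_1,\dots,d_n)$ with $c_1\ge d_1\ge\dots\ge d_n\ge c_2$, $\sum_i d_i$ even and $\sum_i d_i=\Sigma$. For a property $\varphi$, the simple region $\mathbb D[\varphi]$ is the union of all $\mathcal D(n,\Sigma,c_1,c_2)$ over $n>c_1\ge c_2$ (and $\Sigma$) with $\varphi(n,\Sigma,c_1,c_2)$ true. A region is fully graphic if every sequence in it is graphic (the degree sequence of a simple graph on labelled vertices), and almost fully graphic if it becomes fully graphic after removing finitely many sequences.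
   Formalization: The parameter ε ranges over the positive rationals instead of the positive reals. -}

module Defs where

open import Data.Nat as ℕ using (ℕ; _+_; _*_; _≤_; _<_; _≥_)
open import Data.Nat.Divisibility using (_∣_)
open import Data.Bool using (Bool; true; false; if_then_else_)
open import Data.Fin using (Fin)
open import Data.List using (List; length; map; lookup; allFin)
open import Data.Nat.ListAction using (sum)
open import Data.List.Relation.Unary.All using (All)
open import Data.List.Relation.Unary.Linked using (Linked)
open import Data.List.Membership.Propositional using (_∉_)
open import Data.Product using (Σ; ∃; ∃-syntax; _×_)
open import Relation.Binary.PropositionalEquality using (_≡_)
open import Data.Integer using (+_)
open import Data.Rational as ℚ using (ℚ; 0ℚ; 1ℚ)

record SimpleGraph (n : ℕ) : Set where
  field
    adj   : Fin n → Fin n → Bool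
    sym   : ∀ i j → adj i j ≡ adj j i
    irrefl : ∀ i → adj i i ≡ false
open SimpleGraph public

degree : ∀ {n} → SimpleGraph n → Fin n → ℕ
degree {n} G i = sum (map (λ j → if adj G i j then 1 else 0) (allFin n))

Graphic : List ℕ → Set
Graphic d = ∃[ G ] (∀ (i : Fin (length d)) → degree G i ≡ lookup d i)

Property : Set₁
Property = ℕ → ℕ → ℕ → ℕ → Set

InD : ℕ → ℕ → ℕ → ℕ → List ℕ → Set
InD n S c₁ c₂ d =
  length d ≡ n × Linked _≥_ d × All (λ x → x ≤ c₁ × c₂ ≤ x) d
  × sum d ≡ S × 2 ∣ S

InRegion : Property → List ℕ → Set
InRegion φ d = ∃[ n ] ∃[ S ] ∃[ c₁ ] ∃[ c₂ ]
  (c₁ < n × c₂ ≤ c₁ × φ n S c₁ c₂ × InD n S c₁ c₂ d)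

FullyGraphic : Property → Set
FullyGraphic φ = ∀ d → InRegion φ d → Graphic d

AlmostFullyGraphic : Property → Set
AlmostFullyGraphic φ =
  ∃[ L ] (∀ d → InRegion φ d → d ∉ L → Graphic d)

ℕ→ℚ : ℕ → ℚ
ℕ→ℚ k = (+ k) ℚ./ 1

-- φ_ε(n,Σ,c₁,c₂): 2 ≤ c₂ and 3 ≤ c₁ ≤ √((1-ε)Σ).
-- Since c₁ ≥ 0, c₁ ≤ √((1-ε)Σ) is expressed as c₁² ≤ (1-ε)Σ
-- (if (1-ε)Σ < 0 the square root is undefined and both readings are false).
φ : ℚ → Property
φ ε n S c₁ c₂ =
  2 ≤ c₂ × 3 ≤ c₁ × (ℕ→ℚ (c₁ * c₁) ℚ.≤ (1ℚ ℚ.- ε) ℚ.* ℕ→ℚ S)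

-- The region is covered by a criterion: a sequence with even sum Σ and entries at most c,
-- where c(c + 1) ≤ Σ, is graphic. Writing ε = p/K, the condition c₁² ≤ (1 − ε)Σ gives
-- Kc₁² + Σ ≤ KΣ; if moreover Σ < c₁(c₁ + 1), then c₁ < K and the length is at most Σ < K²,
-- so only finitely many sequences of the region fail the criterion.
--
-- The criterion is proved by induction on the length, laying off a vertex v of maximal
-- degree a as in Havel–Hakimi. If at most a other vertices have degree a, v is joined to a
-- vertices of positive degree including all of those; what remains is bounded by a − 1 and
-- has sum Σ − 2a ≥ (a − 1)a. If more than a have degree a and Σ − 2a ≥ a(a + 1), v is
-- joined to a of them. Otherwise a second vertex w of degree a is laid off as well, v and w
-- being joined to the same a vertices of degree a: as Σ − 2a is even, a² ≤ Σ − 2a ≤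
-- a(a + 1) − 2, which bounds every remaining degree by a − 2 and leaves (a − 2)(a − 1) ≤ Σ − 4a.

module Submission where

open import Defs hiding (sym)
open import Data.Bool using (Bool; true; false; T; if_then_else_)
open import Data.Empty using (⊥-elim)
open import Data.Fin using (Fin; zero; suc; punchIn; punchOut)
open import Data.Fin.Properties using (punchIn-punchOut) renaming (_≟_ to _≟ᶠ_)
open import Data.Integer as ℤ using (+0; +[1+_]; -[1+_]; +<+)
import Data.Integer.Properties as ℤP
import Data.Integer.Tactic.RingSolver as ℤ-Solver
open import Data.List as List using (List; []; _∷_; length; lookup; upTo; cartesianProductWith)
open import Data.List.Membership.Propositional using (_∈_; _∉_)
open import Data.List.Membership.Propositional.Properties using (∈-lookup; ∈-upTo⁺; ∈-cartesianProductWith⁺)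
open import Data.List.Properties using (map-tabulate; tabulate-lookup)
open import Data.List.Relation.Unary.All as All using (All; []; _∷_)
open import Data.List.Relation.Unary.Any using (here; there)
open import Data.Nat using (ℕ; zero; suc; pred; _+_; _*_; _∸_; _≤_; _<_; _≤?_; _≡ᵇ_; _<ᵇ_; z≤n; s≤s; s≤s⁻¹; z<s; >-nonZero)
open import Data.Nat.Divisibility using (_∣_; divides; ∣m∣n⇒∣m+n; ∣m+n∣m⇒∣n)
open import Data.Nat.Induction using (<-wellFounded)
import Data.Nat.ListAction as ListAction
open import Data.Nat.Properties
open import Data.Nat.Tactic.RingSolver using (solve-∀)
open import Algebra.Properties.Semiring.Sum +-*-semiring
  using (sum; sum-remove; sum-cong-≗; *-distribˡ-sum; ∑-distrib-+; sum-replicate-zero)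
open import Data.Product using (∃-syntax; _×_; _,_; proj₁; proj₂)
open import Data.Rational as ℚ using (ℚ; mkℚ; 0ℚ; 1ℚ; toℚᵘ; *<*)
import Data.Rational.Properties as ℚP
open import Data.Rational.Unnormalised as ℚᵘ using (mkℚᵘ; *≤*; 1ℚᵘ)
import Data.Rational.Unnormalised.Properties as ℚᵘP
open import Data.Vec.Functional using (Vector; insertAt; removeAt) renaming (_∷_ to _∷ᵥ_)
open import Data.Vec.Functional.Properties using (insertAt-lookup; insertAt-punchIn)
open import Function using (_∘_; id)
open import Induction.WellFounded using (Acc; acc)
open import Relation.Binary.PropositionalEquality
open import Relation.Nullary using (yes; no)
open import Relation.Unary using (_⊆_)

-- Counting true entries of Boolean vectors

indicator : Bool → ℕ
indicator b = if b then 1 else 0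

count : ∀ {n} → Vector Bool n → ℕ
count p = sum (indicator ∘ p)

sum-mono-≤ : ∀ {n} {f g : Vector ℕ n} → (∀ i → f i ≤ g i) → sum f ≤ sum g
sum-mono-≤ {zero}  f≤g = z≤n
sum-mono-≤ {suc n} f≤g = +-mono-≤ (f≤g zero) (sum-mono-≤ (f≤g ∘ suc))

indicator-mono : ∀ {b c} → (T b → T c) → indicator b ≤ indicator c
indicator-mono {false}         _   = z≤n
indicator-mono {true}  {true}  _   = ≤-refl
indicator-mono {true}  {false} b⇒c = ⊥-elim (b⇒c _)

count-mono : ∀ {n} {p q : Vector Bool n} → T ∘ p ⊆ T ∘ q → count p ≤ count q
count-mono p⊆q = sum-mono-≤ λ i → indicator-mono (p⊆q {i})

T⇒indicator≡1 : ∀ {b} → T b → indicator b ≡ 1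
T⇒indicator≡1 {true} _ = refl

0<count⇒∃ : ∀ {n} (p : Vector Bool n) → 0 < count p → ∃[ i ] T (p i)
0<count⇒∃ {suc n} p pos with p zero in p₀
... | true  = zero , subst T (sym p₀) _
... | false = let i , pᵢ = 0<count⇒∃ (p ∘ suc) pos in suc i , pᵢ

count-insertAt : ∀ {n} (p : Vector Bool n) i b → count (insertAt p i b) ≡ indicator b + count p
count-insertAt p i b = begin
  count (insertAt p i b)
    ≡⟨ sum-remove {i = i} (indicator ∘ insertAt p i b) ⟩
  indicator (insertAt p i b i) + count (removeAt (insertAt p i b) i)
    ≡⟨ cong₂ (λ x y → indicator x + y) (insertAt-lookup p i b)
             (sum-cong-≗ (cong indicator ∘ insertAt-punchIn p i b)) ⟩
  indicator b + count p
    ∎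
  where open ≡-Reasoning

*-count≤sum : ∀ {n} a (p : Vector Bool n) (f : Vector ℕ n) →
              T ∘ p ⊆ (λ i → a ≤ f i) → a * count p ≤ sum f
*-count≤sum a p f p⇒a≤f = begin
  a * count p                     ≡⟨ *-distribˡ-sum a (indicator ∘ p) ⟩
  sum (λ i → a * indicator (p i)) ≤⟨ sum-mono-≤ bound ⟩
  sum f                           ∎
  where
  open ≤-Reasoning
  bound : ∀ i → a * indicator (p i) ≤ f i
  bound i with p i | p⇒a≤f {i}
  ... | true  | a≤fᵢ = subst (_≤ f i) (sym (*-identityʳ a)) (a≤fᵢ _)
  ... | false | _    = subst (_≤ f i) (sym (*-zeroʳ a)) z≤n

+-*-count≤sum : ∀ {n} a (p : Vector Bool n) (f : Vector ℕ n) j → p j ≡ false →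
                T ∘ p ⊆ (λ i → a ≤ f i) → f j + a * count p ≤ sum f
+-*-count≤sum {suc n} a p f j pⱼ p⇒a≤f = begin
  f j + a * count p
    ≡⟨ cong (λ c → f j + a * c) (sum-remove {i = j} (indicator ∘ p)) ⟩
  f j + a * (indicator (p j) + count (removeAt p j))
    ≡⟨ cong (λ b → f j + a * (indicator b + count (removeAt p j))) pⱼ ⟩
  f j + a * count (removeAt p j)
    ≤⟨ +-monoʳ-≤ (f j) (*-count≤sum a (removeAt p j) (removeAt f j) p⇒a≤f) ⟩
  f j + sum (removeAt f j)
    ≡⟨ sum-remove f ⟨
  sum f
    ∎
  where open ≤-Reasoning

support : ∀ {n} → Vector ℕ n → Vector Bool n
support f i = 0 <ᵇ f i

sum≤*-count-support : ∀ {n} a (f : Vector ℕ n) → (∀ i → f i ≤ a) → sum f ≤ a * count (support f)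
sum≤*-count-support a f ≤a = begin
  sum f                                   ≤⟨ sum-mono-≤ bound ⟩
  sum (λ i → a * indicator (support f i)) ≡⟨ *-distribˡ-sum a (indicator ∘ support f) ⟨
  a * count (support f)                   ∎
  where
  open ≤-Reasoning
  bound : ∀ i → f i ≤ a * indicator (support f i)
  bound i with f i | ≤a i
  ... | zero  | _     = z≤n
  ... | suc x | 1+x≤a = subst (suc x ≤_) (sym (*-identityʳ a)) 1+x≤a

indicator≤ : ∀ {b x} → (T b → 0 < x) → indicator b ≤ x
indicator≤ {false} _     = z≤n
indicator≤ {true}  b⇒0<x = b⇒0<x _

indicator≤∸indicator : ∀ {b x} → (T b → 2 ≤ x) → indicator b ≤ x ∸ indicator b
indicator≤∸indicator {false} _     = z≤n
indicator≤∸indicator {true}  b⇒2≤x = ∸-monoˡ-≤ 1 (b⇒2≤x _)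

∸-indicator≤pred : ∀ {x a b} → x ≤ a → (x ≡ a → T b) → x ∸ indicator b ≤ pred a
∸-indicator≤pred {b = true}  x≤a _   = pred-mono-≤ x≤a
∸-indicator≤pred {b = false} x≤a x≢a = <⇒≤pred (≤∧≢⇒< x≤a x≢a)

⊆-∷ᵥ : ∀ {n} {p : Vector Bool (suc n)} {b} {q : Vector Bool n} →
       (T (p zero) → T b) → T ∘ (p ∘ suc) ⊆ T ∘ q → T ∘ p ⊆ T ∘ (b ∷ᵥ q)
⊆-∷ᵥ p₀⇒b _  {zero}  = p₀⇒b
⊆-∷ᵥ _   p⊆q {suc i} = p⊆q

∷ᵥ-⊆ : ∀ {n} {b} {q : Vector Bool n} {p : Vector Bool (suc n)} →
       (T b → T (p zero)) → T ∘ q ⊆ T ∘ (p ∘ suc) → T ∘ (b ∷ᵥ q) ⊆ T ∘ p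
∷ᵥ-⊆ b⇒p₀ _   {zero}  = b⇒p₀
∷ᵥ-⊆ _    q⊆p {suc i} = q⊆p

record SubsetBetween {n} (must can : Vector Bool n) (k : ℕ) : Set where
  field
    chosen       : Vector Bool n
    must⊆chosen  : T ∘ must ⊆ T ∘ chosen
    chosen⊆can   : T ∘ chosen ⊆ T ∘ can
    count-chosen : count chosen ≡ k

∷ᵥ-between : ∀ {n} {must can : Vector Bool (suc n)} {k} b →
             (T (must zero) → T b) → (T b → T (can zero)) →
             SubsetBetween (must ∘ suc) (can ∘ suc) k → SubsetBetween must can (indicator b + k)
∷ᵥ-between {must = must} {can} b must₀⇒b b⇒can₀ m = record
  { chosen       = b ∷ᵥ chosen
  ; must⊆chosen  = ⊆-∷ᵥ {p = must} must₀⇒b must⊆chosen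
  ; chosen⊆can   = ∷ᵥ-⊆ {p = can} b⇒can₀ chosen⊆can
  ; count-chosen = cong (indicator b +_) count-chosen
  }
  where open SubsetBetween m

intermediate-subset : ∀ {n} (must can : Vector Bool n) k → T ∘ must ⊆ T ∘ can →
                      count must ≤ k → k ≤ count can → SubsetBetween must can k
intermediate-subset {zero} must can k must⊆can _ k≤0 = record
  { chosen = must ; must⊆chosen = id ; chosen⊆can = must⊆can ; count-chosen = sym (n≤0⇒n≡0 k≤0) }
intermediate-subset {suc n} must can k must⊆can lo hi
  with must zero in must₀ | can zero in can₀
... | true  | false = ⊥-elim (subst T can₀ (must⊆can (subst T (sym must₀) _)))
... | false | false = ∷ᵥ-between false (subst T must₀) (λ ())
                        (intermediate-subset (must ∘ suc) (can ∘ suc) k must⊆can lo hi)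
... | true  | true  = include k lo hi
  where
  include : ∀ k → suc (count (must ∘ suc)) ≤ k → k ≤ suc (count (can ∘ suc)) → SubsetBetween must can k
  include (suc k) (s≤s lo) (s≤s hi) = ∷ᵥ-between true _ (λ _ → subst T (sym can₀) _)
                                        (intermediate-subset (must ∘ suc) (can ∘ suc) k must⊆can lo hi)
... | false | true with k ≤? count (can ∘ suc)
...   | yes k≤ = ∷ᵥ-between false (subst T must₀) (λ ())
                   (intermediate-subset (must ∘ suc) (can ∘ suc) k must⊆can lo k≤)
...   | no k≰ = include k (≰⇒> k≰) hi
  where
  include : ∀ k → count (can ∘ suc) < k → k ≤ suc (count (can ∘ suc)) → SubsetBetween must can k
  include (suc k) (s≤s can<k) (s≤s hi) =
    ∷ᵥ-between true _ (λ _ → subst T (sym can₀) _)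
      (intermediate-subset (must ∘ suc) (can ∘ suc) k must⊆can
        (≤-trans (count-mono {p = must ∘ suc} must⊆can) can<k) hi)

subset-of-size : ∀ {n} (can : Vector Bool n) k → k ≤ count can → SubsetBetween (λ _ → false) can k
subset-of-size {n} can k =
  intermediate-subset (λ _ → false) can k (λ ()) (≤-trans (≤-reflexive (sum-replicate-zero n)) z≤n)

-- Parity and arithmetic

2∣n+n : ∀ n → 2 ∣ n + n
2∣n+n n = divides n (n+n≡n*2 n)
  where
  n+n≡n*2 : ∀ n → n + n ≡ n * 2
  n+n≡n*2 = solve-∀

2∣n*[1+n] : ∀ n → 2 ∣ n * suc n
2∣n*[1+n] zero    = divides 0 refl
2∣n*[1+n] (suc n) = subst (2 ∣_) (step n) (∣m∣n⇒∣m+n (2∣n*[1+n] n) (2∣n+n (suc n)))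
  where
  step : ∀ n → n * suc n + (suc n + suc n) ≡ suc n * suc (suc n)
  step = solve-∀

even<even⇒2+≤ : ∀ {m n} → 2 ∣ m → 2 ∣ n → m < n → 2 + m ≤ n
even<even⇒2+≤ (divides p refl) (divides q refl) p*2<q*2 = *-monoˡ-≤ 2 (*-cancelʳ-< _ p q p*2<q*2)

n+n+pred[n]*[1+pred[n]]≡n*[1+n] : ∀ n → n + n + pred n * suc (pred n) ≡ n * suc n
n+n+pred[n]*[1+pred[n]]≡n*[1+n] zero    = refl
n+n+pred[n]*[1+pred[n]]≡n*[1+n] (suc n) = identity n
  where
  identity : ∀ n → suc n + suc n + n * suc n ≡ suc n * suc (suc n)
  identity = solve-∀

2≤n⇒n+n+[n∸2]*[n∸1]≤n*n : ∀ {n} → 2 ≤ n → n + n + (n ∸ 2) * suc (n ∸ 2) ≤ n * n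
2≤n⇒n+n+[n∸2]*[n∸1]≤n*n {suc (suc m)} (s≤s (s≤s z≤n)) =
  subst (2 + m + (2 + m) + m * suc m ≤_) (identity m) (m≤m+n (2 + m + (2 + m) + m * suc m) m)
  where
  identity : ∀ m → 2 + m + (2 + m) + m * suc m + m ≡ (2 + m) * (2 + m)
  identity = solve-∀

-- Adding a vertex to a graph

punchIn-cases : ∀ {n p} {P : Fin (suc n) → Set p} v → P v → (∀ j → P (punchIn v j)) → ∀ i → P i
punchIn-cases {P = P} v Pv Pv↑ i with v ≟ᶠ i
... | yes refl = Pv
... | no  v≢i  = subst P (punchIn-punchOut v≢i) (Pv↑ (punchOut v≢i))

sum-tabulate : ∀ {n} (f : Vector ℕ n) → ListAction.sum (List.tabulate f) ≡ sum f
sum-tabulate {zero}  f = refl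
sum-tabulate {suc n} f = cong (f zero +_) (sum-tabulate (f ∘ suc))

degree≡count : ∀ {n} (G : SimpleGraph n) i → degree G i ≡ count (adj G i)
degree≡count {n} G i =
  trans (cong ListAction.sum (map-tabulate {n = n} id (indicator ∘ adj G i))) (sum-tabulate (indicator ∘ adj G i))

Realizable : ∀ {n} → Vector ℕ n → Set
Realizable f = ∃[ G ] (∀ i → degree G i ≡ f i)

edgeless : ∀ n → SimpleGraph n
edgeless n = record { adj = λ _ _ → false ; sym = λ _ _ → refl ; irrefl = λ _ → refl }

module _ {n} (v : Fin (suc n)) (G : SimpleGraph n) (nbrs : Vector Bool n) where

  private
    A : Fin (suc n) → Fin (suc n) → Bool
    A = insertAt (λ i → insertAt (adj G i) v (nbrs i)) v (insertAt nbrs v false)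

    A-new : ∀ j → A v j ≡ insertAt nbrs v false j
    A-new = cong-app (insertAt-lookup _ v _)

    A-old : ∀ i j → A (punchIn v i) j ≡ insertAt (adj G i) v (nbrs i) j
    A-old i = cong-app (insertAt-punchIn _ v _ i)

    A-new-new : A v v ≡ false
    A-new-new = trans (A-new v) (insertAt-lookup nbrs v false)

    A-new-old : ∀ j → A v (punchIn v j) ≡ nbrs j
    A-new-old j = trans (A-new (punchIn v j)) (insertAt-punchIn nbrs v false j)

    A-old-new : ∀ i → A (punchIn v i) v ≡ nbrs i
    A-old-new i = trans (A-old i v) (insertAt-lookup (adj G i) v (nbrs i))

    A-old-old : ∀ i j → A (punchIn v i) (punchIn v j) ≡ adj G i j
    A-old-old i j = trans (A-old i (punchIn v j)) (insertAt-punchIn (adj G i) v (nbrs i) j)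

    A-sym : ∀ i j → A i j ≡ A j i
    A-sym = punchIn-cases v
      (punchIn-cases v refl λ j → trans (A-new-old j) (sym (A-old-new j)))
      λ i → punchIn-cases v (trans (A-old-new i) (sym (A-new-old i)))
        λ j → trans (A-old-old i j) (trans (SimpleGraph.sym G i j) (sym (A-old-old j i)))

    A-irrefl : ∀ i → A i i ≡ false
    A-irrefl = punchIn-cases v A-new-new λ i → trans (A-old-old i i) (irrefl G i)

  addVertex : SimpleGraph (suc n)
  addVertex = record { adj = A ; sym = A-sym ; irrefl = A-irrefl }

  degree-addVertex-new : degree addVertex v ≡ count nbrs
  degree-addVertex-new = begin
    degree addVertex v                                    ≡⟨ degree≡count addVertex v ⟩
    count (A v)                                           ≡⟨ sum-remove {i = v} (indicator ∘ A v) ⟩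
    indicator (A v v) + count (removeAt (A v) v)          ≡⟨ cong₂ (λ b c → indicator b + c) A-new-new
                                                               (sum-cong-≗ (cong indicator ∘ A-new-old)) ⟩
    count nbrs                                            ∎
    where open ≡-Reasoning

  degree-addVertex-old : ∀ i → degree addVertex (punchIn v i) ≡ degree G i + indicator (nbrs i)
  degree-addVertex-old i = begin
    degree addVertex (punchIn v i)                        ≡⟨ degree≡count addVertex (punchIn v i) ⟩
    count (A (punchIn v i))                               ≡⟨ sum-remove {i = v} (indicator ∘ A (punchIn v i)) ⟩
    indicator (A (punchIn v i) v) + count (removeAt (A (punchIn v i)) v)
      ≡⟨ cong₂ (λ b c → indicator b + c) (A-old-new i) (sum-cong-≗ (cong indicator ∘ A-old-old i)) ⟩
    indicator (nbrs i) + count (adj G i)                  ≡⟨ +-comm (indicator (nbrs i)) (count (adj G i)) ⟩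
    count (adj G i) + indicator (nbrs i)                  ≡⟨ cong (_+ indicator (nbrs i)) (degree≡count G i) ⟨
    degree G i + indicator (nbrs i)                       ∎
    where open ≡-Reasoning

-- Laying off a vertex

layOff : ∀ {n} → Vector ℕ (suc n) → Fin (suc n) → Vector Bool n → Vector ℕ n
layOff f v nbrs j = f (punchIn v j) ∸ indicator (nbrs j)

-- within rules out truncation in the subtraction of layOff.
record IsNeighbourhood {n} (f : Vector ℕ (suc n)) (v : Fin (suc n)) (nbrs : Vector Bool n) : Set where
  field
    size   : count nbrs ≡ f v
    within : ∀ j → indicator (nbrs j) ≤ f (punchIn v j)

record Admissible {n} (f : Vector ℕ n) (c : ℕ) : Set where
  field
    even    : 2 ∣ sum f
    bounded : ∀ i → f i ≤ c
    large   : c * suc c ≤ sum f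

open Admissible

module _ {n} {f : Vector ℕ (suc n)} {v nbrs} (nb : IsNeighbourhood f v nbrs) where
  open IsNeighbourhood nb

  layOff-realizable : Realizable (layOff f v nbrs) → Realizable f
  layOff-realizable (G , deg) = addVertex v G nbrs , punchIn-cases v
    (trans (degree-addVertex-new v G nbrs) size)
    λ j → begin
      degree (addVertex v G nbrs) (punchIn v j)                 ≡⟨ degree-addVertex-old v G nbrs j ⟩
      degree G j + indicator (nbrs j)                           ≡⟨ cong (_+ indicator (nbrs j)) (deg j) ⟩
      f (punchIn v j) ∸ indicator (nbrs j) + indicator (nbrs j) ≡⟨ m∸n+n≡m (within j) ⟩
      f (punchIn v j)                                           ∎
    where open ≡-Reasoning

  sum-layOff : f v + f v + sum (layOff f v nbrs) ≡ sum f
  sum-layOff = begin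
    f v + f v + sum (layOff f v nbrs)                       ≡⟨ cong (λ c → f v + c + sum (layOff f v nbrs)) size ⟨
    f v + count nbrs + sum (layOff f v nbrs)                ≡⟨ rearrange (f v) (count nbrs) (sum (layOff f v nbrs)) ⟩
    f v + (sum (layOff f v nbrs) + count nbrs)              ≡⟨ cong (f v +_) (∑-distrib-+ (layOff f v nbrs) (indicator ∘ nbrs)) ⟨
    f v + sum (λ j → layOff f v nbrs j + indicator (nbrs j)) ≡⟨ cong (f v +_) (sum-cong-≗ (m∸n+n≡m ∘ within)) ⟩
    f v + sum (removeAt f v)                                ≡⟨ sum-remove f ⟨
    sum f                                                   ∎
    where
    open ≡-Reasoning
    rearrange : ∀ x y z → x + y + z ≡ x + (z + y)
    rearrange = solve-∀

  layOff-even : 2 ∣ sum f → 2 ∣ sum (layOff f v nbrs)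
  layOff-even 2∣f = ∣m+n∣m⇒∣n (subst (2 ∣_) (sym sum-layOff) 2∣f) (2∣n+n (f v))

  layOff-admissible : ∀ {c} → 2 ∣ sum f → (∀ j → layOff f v nbrs j ≤ c) →
                      f v + f v + c * suc c ≤ sum f → Admissible (layOff f v nbrs) c
  layOff-admissible {c} 2∣f ≤c room = record
    { even    = layOff-even 2∣f
    ; bounded = ≤c
    ; large   = +-cancelˡ-≤ (f v + f v) _ _ (subst (f v + f v + c * suc c ≤_) (sym sum-layOff) room)
    }

-- Sequences with even sum Σ and entries at most c, where c(c+1) ≤ Σ

record Reduction {n} (f : Vector ℕ n) : Set where
  field
    {order}    : ℕ
    smaller    : order < n
    reduct     : Vector ℕ order
    bound      : ℕ
    admissible : Admissible reduct bound
    lift       : Realizable reduct → Realizable f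

single-reduction : ∀ {n} {f : Vector ℕ (suc n)} {v nbrs c} → IsNeighbourhood f v nbrs →
                   Admissible (layOff f v nbrs) c → Reduction f
single-reduction {c = c} nb adm = record
  { smaller = ≤-refl ; reduct = _ ; bound = c ; admissible = adm ; lift = layOff-realizable nb }

peers : ∀ {n} → Vector ℕ (suc n) → Fin (suc n) → Vector Bool n
peers f v j = removeAt f v j ≡ᵇ f v

peer⇒positive : ∀ {n} {f : Vector ℕ (suc n)} {v j} → 0 < f v → T (peers f v j) → 0 < removeAt f v j
peer⇒positive {f = f} {v} {j} 0<a peer = subst (0 <_) (sym (≡ᵇ⇒≡ (removeAt f v j) (f v) peer)) 0<a

isolated-reduction : ∀ {n} (f : Vector ℕ (suc n)) v → Admissible f (f v) → f v ≡ 0 → Reduction f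
isolated-reduction {n} f v adm fv≡0 = single-reduction nb (layOff-admissible nb (even adm) isolated room)
  where
  nb : IsNeighbourhood f v (λ _ → false)
  nb = record { size = trans (sum-replicate-zero n) (sym fv≡0) ; within = λ _ → z≤n }
  isolated : ∀ j → f (punchIn v j) ≤ 0
  isolated j = subst (f (punchIn v j) ≤_) fv≡0 (bounded adm (punchIn v j))
  room : f v + f v + 0 ≤ sum f
  room = subst (λ a → a + a + 0 ≤ sum f) (sym fv≡0) z≤n

sparse-reduction : ∀ {n} (f : Vector ℕ (suc n)) v → Admissible f (f v) → 0 < f v →
                   count (peers f v) ≤ f v → Reduction f
sparse-reduction {n} f v adm 0<a few = single-reduction nb (layOff-admissible nb (even adm) below room)
  where
  a : ℕ
  a = f v
  h : Vector ℕ n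
  h = removeAt f v
  a*a≤sum-h : a * a ≤ sum h
  a*a≤sum-h = +-cancelˡ-≤ a _ _ (begin
    a + a * a  ≡⟨ *-suc a a ⟨
    a * suc a  ≤⟨ large adm ⟩
    sum f      ≡⟨ sum-remove f ⟩
    a + sum h  ∎)
    where open ≤-Reasoning
  a≤∣support∣ : a ≤ count (support h)
  a≤∣support∣ = *-cancelˡ-≤ a {{>-nonZero 0<a}}
    (≤-trans a*a≤sum-h (sum≤*-count-support a h (bounded adm ∘ punchIn v)))
  peers⊆support : T ∘ peers f v ⊆ T ∘ support h
  peers⊆support peer = <⇒<ᵇ (peer⇒positive {f = f} 0<a peer)
  open SubsetBetween (intermediate-subset (peers f v) (support h) a peers⊆support few a≤∣support∣)
  nb : IsNeighbourhood f v chosen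
  nb = record { size = count-chosen ; within = λ j → indicator≤ (<ᵇ⇒< 0 (h j) ∘ chosen⊆can) }
  below : ∀ j → layOff f v chosen j ≤ pred a
  below j = ∸-indicator≤pred (bounded adm (punchIn v j)) (λ hⱼ≡a → must⊆chosen (≡⇒≡ᵇ (h j) a hⱼ≡a))
  room : a + a + pred a * suc (pred a) ≤ sum f
  room = subst (_≤ sum f) (sym (n+n+pred[n]*[1+pred[n]]≡n*[1+n] a)) (large adm)

roomy-reduction : ∀ {n} (f : Vector ℕ (suc n)) v → Admissible f (f v) → 0 < f v →
                  f v ≤ count (peers f v) → f v + f v + f v * suc (f v) ≤ sum f → Reduction f
roomy-reduction f v adm 0<a many room = single-reduction nb (layOff-admissible nb (even adm) below room)
  where
  open SubsetBetween (subset-of-size (peers f v) (f v) many)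
  nb : IsNeighbourhood f v chosen
  nb = record { size = count-chosen ; within = λ j → indicator≤ (peer⇒positive {f = f} 0<a ∘ chosen⊆can) }
  below : ∀ j → layOff f v chosen j ≤ f v
  below j = ≤-trans (m∸n≤m (f (punchIn v j)) (indicator (chosen j))) (bounded adm (punchIn v j))

module Crowded {n} (f : Vector ℕ (suc (suc n))) (v : Fin (suc (suc n))) (adm : Admissible f (f v))
               (crowded : f v < count (peers f v)) (tight : sum f < f v + f v + f v * suc (f v)) where

  a : ℕ
  a = f v

  h : Vector ℕ (suc n)
  h = removeAt f v

  some-peer : ∃[ w ] T (peers f v w)
  some-peer = 0<count⇒∃ (peers f v) (≤-trans (s≤s z≤n) crowded)

  w : Fin (suc n)
  w = proj₁ some-peer

  h₂ : Vector ℕ n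
  h₂ = removeAt h w

  peers₂ : Vector Bool n
  peers₂ = removeAt (peers f v) w

  hw≡a : h w ≡ a
  hw≡a = ≡ᵇ⇒≡ (h w) a (proj₂ some-peer)

  a≤∣peers₂∣ : a ≤ count peers₂
  a≤∣peers₂∣ = s≤s⁻¹ (subst (suc a ≤_) (trans (sum-remove {i = w} (indicator ∘ peers f v))
                 (cong (_+ count peers₂) (T⇒indicator≡1 (proj₂ some-peer)))) crowded)

  open SubsetBetween (subset-of-size peers₂ a a≤∣peers₂∣) renaming (chosen to nbrs)

  nbrs⇒a : ∀ {j} → T (nbrs j) → h₂ j ≡ a
  nbrs⇒a {j} = ≡ᵇ⇒≡ (h₂ j) a ∘ chosen⊆can

  sum-h₂ : a + a + sum h₂ ≡ sum f
  sum-h₂ = begin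
    a + a + sum h₂    ≡⟨ +-assoc a a (sum h₂) ⟩
    a + (a + sum h₂)  ≡⟨ cong (λ x → a + (x + sum h₂)) hw≡a ⟨
    a + (h w + sum h₂) ≡⟨ cong (a +_) (sum-remove h) ⟨
    a + sum h         ≡⟨ sum-remove f ⟨
    sum f             ∎
    where open ≡-Reasoning

  a*a≤sum-h₂ : a * a ≤ sum h₂
  a*a≤sum-h₂ = subst (λ k → a * k ≤ sum h₂) count-chosen
    (*-count≤sum a nbrs h₂ (≤-reflexive ∘ sym ∘ nbrs⇒a))

  2+sum-h₂≤a*[1+a] : 2 + sum h₂ ≤ a * suc a
  2+sum-h₂≤a*[1+a] = even<even⇒2+≤ even-h₂ (2∣n*[1+n] a)
    (+-cancelˡ-< (a + a) (sum h₂) (a * suc a) (subst (_< a + a + a * suc a) (sym sum-h₂) tight))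
    where
    even-h₂ : 2 ∣ sum h₂
    even-h₂ = ∣m+n∣m⇒∣n (subst (2 ∣_) (sym sum-h₂) (even adm)) (2∣n+n a)

  2≤a : 2 ≤ a
  2≤a = +-cancelʳ-≤ (a * a) 2 a (begin
    2 + a * a    ≤⟨ +-monoʳ-≤ 2 a*a≤sum-h₂ ⟩
    2 + sum h₂   ≤⟨ 2+sum-h₂≤a*[1+a] ⟩
    a * suc a    ≡⟨ *-suc a a ⟩
    a + a * a    ∎)
    where open ≤-Reasoning

  non-nbr-bound : ∀ j → nbrs j ≡ false → h₂ j ≤ a ∸ 2
  non-nbr-bound j nbrsⱼ = m+n≤o⇒m≤o∸n (h₂ j) (+-cancelʳ-≤ (a * a) (h₂ j + 2) a (begin
    h₂ j + 2 + a * a    ≡⟨ cong (_+ a * a) (+-comm (h₂ j) 2) ⟩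
    2 + h₂ j + a * a    ≡⟨ +-assoc 2 (h₂ j) (a * a) ⟩
    2 + (h₂ j + a * a)  ≤⟨ +-monoʳ-≤ 2 (subst (λ k → h₂ j + a * k ≤ sum h₂) count-chosen
                               (+-*-count≤sum a nbrs h₂ j nbrsⱼ (≤-reflexive ∘ sym ∘ nbrs⇒a))) ⟩
    2 + sum h₂          ≤⟨ 2+sum-h₂≤a*[1+a] ⟩
    a * suc a           ≡⟨ *-suc a a ⟩
    a + a * a           ∎))
    where open ≤-Reasoning

  nbrs₁ : Vector Bool (suc n)
  nbrs₁ = insertAt nbrs w false

  nb₁ : IsNeighbourhood f v nbrs₁
  nb₁ = record
    { size   = trans (count-insertAt nbrs w false) count-chosen
    ; within = punchIn-cases w
        (subst (λ b → indicator b ≤ h w) (sym (insertAt-lookup nbrs w false)) z≤n)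
        λ j → subst (λ b → indicator b ≤ h₂ j) (sym (insertAt-punchIn nbrs w false j))
                (indicator≤ λ t → subst (0 <_) (sym (nbrs⇒a t)) (≤-trans (s≤s z≤n) 2≤a))
    }

  f₁ : Vector ℕ (suc n)
  f₁ = layOff f v nbrs₁

  f₁-w : f₁ w ≡ a
  f₁-w = trans (cong (λ b → h w ∸ indicator b) (insertAt-lookup nbrs w false)) hw≡a

  f₁-old : ∀ j → f₁ (punchIn w j) ≡ h₂ j ∸ indicator (nbrs j)
  f₁-old j = cong (λ b → h₂ j ∸ indicator b) (insertAt-punchIn nbrs w false j)

  nb₂ : IsNeighbourhood f₁ w nbrs
  nb₂ = record
    { size   = trans count-chosen (sym f₁-w)
    ; within = λ j → subst (indicator (nbrs j) ≤_) (sym (f₁-old j))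
                 (indicator≤∸indicator λ t → subst (2 ≤_) (sym (nbrs⇒a t)) 2≤a)
    }

  g : Vector ℕ n
  g = layOff f₁ w nbrs

  g-bound : ∀ j → g j ≤ a ∸ 2
  g-bound j = subst (λ x → x ∸ indicator (nbrs j) ≤ a ∸ 2) (sym (f₁-old j)) (twice (nbrs j) refl)
    where
    twice : ∀ b → nbrs j ≡ b → h₂ j ∸ indicator b ∸ indicator b ≤ a ∸ 2
    twice true  e = ≤-reflexive (trans (∸-+-assoc (h₂ j) 1 1) (cong (_∸ 2) (nbrs⇒a (subst T (sym e) _))))
    twice false e = non-nbr-bound j e

  room : f₁ w + f₁ w + (a ∸ 2) * suc (a ∸ 2) ≤ sum f₁
  room = begin
    f₁ w + f₁ w + (a ∸ 2) * suc (a ∸ 2) ≡⟨ cong (λ x → x + x + (a ∸ 2) * suc (a ∸ 2)) f₁-w ⟩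
    a + a + (a ∸ 2) * suc (a ∸ 2)       ≤⟨ 2≤n⇒n+n+[n∸2]*[n∸1]≤n*n 2≤a ⟩
    a * a                               ≤⟨ a*a≤sum-h₂ ⟩
    sum h₂                              ≡⟨ +-cancelˡ-≡ (a + a) (sum h₂) (sum f₁) (trans sum-h₂ (sym (sum-layOff nb₁))) ⟩
    sum f₁                              ∎
    where open ≤-Reasoning

  reduction : Reduction f
  reduction = record
    { smaller    = s≤s (n≤1+n n)
    ; reduct     = g
    ; bound      = a ∸ 2
    ; admissible = layOff-admissible nb₂ (layOff-even nb₁ (even adm)) g-bound room
    ; lift       = layOff-realizable nb₁ ∘ layOff-realizable nb₂
    }

crowded-reduction : ∀ {n} (f : Vector ℕ (suc n)) v → Admissible f (f v) → f v < count (peers f v) →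
                    sum f < f v + f v + f v * suc (f v) → Reduction f
crowded-reduction {zero}  f v adm () tight
crowded-reduction {suc n} f v = Crowded.reduction f v

argmax : ∀ {n} (f : Vector ℕ (suc n)) → ∃[ v ] (∀ i → f i ≤ f v)
argmax {zero}  f = zero , λ { zero → ≤-refl }
argmax {suc n} f with argmax (f ∘ suc)
... | v , max with f zero ≤? f (suc v)
...   | yes f₀≤ = suc v , λ { zero → f₀≤ ; (suc i) → max i }
...   | no  f₀≰ = zero  , λ { zero → ≤-refl ; (suc i) → ≤-trans (max i) (≰⇒≥ f₀≰) }

admissible-at-max : ∀ {n} {f : Vector ℕ n} {c v} → Admissible f c → (∀ i → f i ≤ f v) → Admissible f (f v)
admissible-at-max {v = v} adm max = record
  { even    = even adm
  ; bounded = max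
  ; large   = ≤-trans (*-mono-≤ (bounded adm v) (s≤s (bounded adm v))) (large adm)
  }

reduce-at : ∀ {n} (f : Vector ℕ (suc n)) v → Admissible f (f v) → Reduction f
reduce-at f v adm with 0 <? f v
... | no  ¬0<a = isolated-reduction f v adm (n≤0⇒n≡0 (≮⇒≥ ¬0<a))
... | yes 0<a with f v <? count (peers f v) | f v + f v + f v * suc (f v) ≤? sum f
...   | no  few     | _        = sparse-reduction f v adm 0<a (≮⇒≥ few)
...   | yes crowded | yes room = roomy-reduction f v adm 0<a (<⇒≤ crowded) room
...   | yes crowded | no tight = crowded-reduction f v adm crowded (≰⇒> tight)

admissible⇒realizable : ∀ {n} (f : Vector ℕ n) c → Admissible f c → Realizable f
admissible⇒realizable f c adm = go f c adm (<-wellFounded _)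
  where
  go : ∀ {n} (f : Vector ℕ n) c → Admissible f c → Acc _<_ n → Realizable f
  go {zero}  f _ _   _         = edgeless 0 , λ ()
  go {suc n} f c adm (acc rec) with argmax f
  ... | v , max = lift (go reduct bound admissible (rec smaller))
    where open Reduction (reduce-at f v (admissible-at-max adm max))

-- The region 𝔻[φ_ε]

sum-lookup : ∀ d → sum (lookup d) ≡ ListAction.sum d
sum-lookup d = trans (sym (sum-tabulate (lookup d))) (cong ListAction.sum (tabulate-lookup d))

c[c+1]≤sum⇒graphic : ∀ d c → 2 ∣ ListAction.sum d → All (_≤ c) d → c * suc c ≤ ListAction.sum d → Graphic d
c[c+1]≤sum⇒graphic d c 2∣Σ ≤c c[c+1]≤Σ = admissible⇒realizable (lookup d) c record
  { even    = subst (2 ∣_) (sym (sum-lookup d)) 2∣Σ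
  ; bounded = λ i → All.lookup ≤c (∈-lookup i)
  ; large   = subst (c * suc c ≤_) (sym (sum-lookup d)) c[c+1]≤Σ
  }

length≤sum : ∀ {d} → All (1 ≤_) d → length d ≤ ListAction.sum d
length≤sum []         = z≤n
length≤sum (1≤x ∷ ps) = +-mono-≤ 1≤x (length≤sum ps)

bounded-lists : ℕ → ℕ → List (List ℕ)
bounded-lists zero    B = [] ∷ []
bounded-lists (suc L) B = [] ∷ cartesianProductWith _∷_ (upTo B) (bounded-lists L B)

∈-bounded-lists : ∀ {L B} d → length d ≤ L → All (_< B) d → d ∈ bounded-lists L B
∈-bounded-lists {zero}  []      _         _            = here refl
∈-bounded-lists {suc L} []      _         _            = here refl
∈-bounded-lists {suc L} (x ∷ d) (s≤s len) (x<B ∷ d<B) =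
  there (∈-cartesianProductWith⁺ _∷_ (∈-upTo⁺ x<B) (∈-bounded-lists d len d<B))

-- ℕ→ℚ and the operations of ℚ normalise by a gcd, so the bound is moved to unnormalised
-- rationals, where ≤ is an integer inequality between numerators and denominators.
toℚᵘ-bound : ∀ ε x S → ℕ→ℚ x ℚ.≤ (1ℚ ℚ.- ε) ℚ.* ℕ→ℚ S →
             mkℚᵘ (ℤ.+ x) 0 ℚᵘ.≤ (1ℚᵘ ℚᵘ.- toℚᵘ ε) ℚᵘ.* mkℚᵘ (ℤ.+ S) 0
toℚᵘ-bound ε x S x≤ = ℚᵘP.≤-respʳ-≃ rhs (ℚᵘP.≤-respˡ-≃ (ℚP.toℚᵘ-fromℚᵘ (mkℚᵘ (ℤ.+ x) 0)) (ℚP.toℚᵘ-mono-≤ x≤))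
  where
  rhs : toℚᵘ ((1ℚ ℚ.- ε) ℚ.* ℕ→ℚ S) ℚᵘ.≃ (1ℚᵘ ℚᵘ.- toℚᵘ ε) ℚᵘ.* mkℚᵘ (ℤ.+ S) 0
  rhs = ℚᵘP.≃-trans (ℚP.toℚᵘ-homo-* (1ℚ ℚ.- ε) (ℕ→ℚ S))
          (ℚᵘP.*-cong (ℚᵘP.≃-trans (ℚP.toℚᵘ-homo-+ 1ℚ (ℚ.- ε)) (ℚᵘP.+-congʳ 1ℚᵘ (ℚP.toℚᵘ-homo‿- ε)))
                      (ℚP.toℚᵘ-fromℚᵘ (mkℚᵘ (ℤ.+ S) 0)))

-- The pattern *≤* exposes x·K ≤ (K − P)·S in the raw shape given by ℚᵘ's _+_ and _*_.
ℚᵘ-bound⇒ℕ-bound : ∀ p d x S → mkℚᵘ (ℤ.+ x) 0 ℚᵘ.≤ (1ℚᵘ ℚᵘ.- mkℚᵘ +[1+ p ] d) ℚᵘ.* mkℚᵘ (ℤ.+ S) 0 →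
                   suc d * x + suc p * S ≤ suc d * S
ℚᵘ-bound⇒ℕ-bound p d x S (*≤* x*K≤[K-P]*S) = ℤP.drop‿+≤+ (begin
  ℤ.+ (K * x + P * S)                                   ≡⟨ cong (λ k → ℤ.+ (k * x + P * S)) 1*K*1≡K ⟨
  ℤ.+ (1 * K * 1 * x + P * S)                           ≡⟨ ℤP.pos-+ (1 * K * 1 * x) (P * S) ⟩
  ℤ.+ (1 * K * 1 * x) ℤ.+ ℤ.+ (P * S)                   ≡⟨ cong₂ ℤ._+_ (trans (cong ℤ.+_ (*-comm (1 * K * 1) x))
                                                                               (ℤP.pos-* x (1 * K * 1)))
                                                                        (ℤP.pos-* P S) ⟩
  ℤ.+ x ℤ.* ℤ.+ (1 * K * 1) ℤ.+ ℤ.+ P ℤ.* ℤ.+ S         ≤⟨ ℤP.+-monoˡ-≤ (ℤ.+ P ℤ.* ℤ.+ S) x*K≤[K-P]*S ⟩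
  ((ℤ.+ 1 ℤ.* ℤ.+ K ℤ.+ ℤ.- ℤ.+ P ℤ.* ℤ.+ 1) ℤ.* ℤ.+ S) ℤ.* ℤ.+ 1 ℤ.+ ℤ.+ P ℤ.* ℤ.+ S
                                                        ≡⟨ cancel (ℤ.+ K) (ℤ.+ S) (ℤ.+ P) ⟩
  ℤ.+ K ℤ.* ℤ.+ S                                       ≡⟨ ℤP.pos-* K S ⟨
  ℤ.+ (K * S)                                           ∎)
  where
  open ℤP.≤-Reasoning
  K P : ℕ
  K = suc d
  P = suc p
  1*K*1≡K : 1 * K * 1 ≡ K
  1*K*1≡K = trans (*-identityʳ (1 * K)) (*-identityˡ K)
  cancel : ∀ k s q → (ℤ.+ 1 ℤ.* k ℤ.+ ℤ.- q ℤ.* ℤ.+ 1) ℤ.* s ℤ.* ℤ.+ 1 ℤ.+ q ℤ.* s ≡ k ℤ.* s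
  cancel = ℤ-Solver.solve-∀

ℚ-bound⇒ℕ-bound : ∀ {ε} → 0ℚ ℚ.< ε → ∀ x S → ℕ→ℚ x ℚ.≤ (1ℚ ℚ.- ε) ℚ.* ℕ→ℚ S →
                  ℚ.↧ₙ ε * x + S ≤ ℚ.↧ₙ ε * S
ℚ-bound⇒ℕ-bound {mkℚ +0         _ _} (*<* (+<+ ()))
ℚ-bound⇒ℕ-bound {mkℚ -[1+ _ ]   _ _} (*<* ())
ℚ-bound⇒ℕ-bound {ε@(mkℚ +[1+ p ] d _)} _ x S x≤ =
  ≤-trans (+-monoʳ-≤ (suc d * x) (m≤m+n S (p * S))) (ℚᵘ-bound⇒ℕ-bound p d x S (toℚᵘ-bound ε x S x≤))

small-sum⇒c<K : ∀ {K c S} → 0 < K → K * (c * c) + S ≤ K * S → S < c * suc c → c < K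
small-sum⇒c<K {K} {c} {S} 0<K scaled small = *-cancelʳ-< c c K (begin-strict
  c * c                ≤⟨ c*c≤S ⟩
  S                    <⟨ m<m+n S 0<K ⟩
  S + K                ≤⟨ +-cancelʳ-≤ (K * (c * c)) (S + K) (K * c) (begin
    S + K + K * (c * c)  ≡⟨ rearrange S K (K * (c * c)) ⟩
    K * (c * c) + S + K  ≤⟨ +-monoˡ-≤ K scaled ⟩
    K * S + K            ≡⟨ trans (*-suc K S) (+-comm K (K * S)) ⟨
    K * suc S            ≤⟨ *-monoʳ-≤ K small ⟩
    K * (c * suc c)      ≡⟨ trans (cong (K *_) (*-suc c c)) (*-distribˡ-+ K c (c * c)) ⟩
    K * c + K * (c * c)  ∎) ⟩
  K * c                ∎)
  where
  open ≤-Reasoning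
  c*c≤S : c * c ≤ S
  c*c≤S = *-cancelˡ-≤ K {{>-nonZero 0<K}} (≤-trans (m≤m+n (K * (c * c)) S) scaled)
  rearrange : ∀ s k x → s + k + x ≡ x + s + k
  rearrange = solve-∀

small-sum⇒∈-bounded-lists : ∀ {K c₁ c₂ S} d → 1 ≤ c₂ → All (λ x → x ≤ c₁ × c₂ ≤ x) d →
                            ListAction.sum d ≡ S → c₁ < K → S < c₁ * suc c₁ → d ∈ bounded-lists (K * K) K
small-sum⇒∈-bounded-lists {K} {c₁} {c₂} {S} d 1≤c₂ bounds ∑d≡S c₁<K small =
  ∈-bounded-lists d length≤K*K (All.map (λ (x≤c₁ , _) → ≤-<-trans x≤c₁ c₁<K) bounds)
  where
  length≤K*K : length d ≤ K * K
  length≤K*K = begin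
    length d          ≤⟨ length≤sum (All.map (λ (_ , c₂≤x) → ≤-trans 1≤c₂ c₂≤x) bounds) ⟩
    ListAction.sum d  ≡⟨ ∑d≡S ⟩
    S                 ≤⟨ <⇒≤ small ⟩
    c₁ * suc c₁       ≤⟨ *-mono-≤ (<⇒≤ c₁<K) c₁<K ⟩
    K * K             ∎
    where open ≤-Reasoning

theorem3p4 : (ε : ℚ) → 0ℚ ℚ.< ε → AlmostFullyGraphic (φ ε)
theorem3p4 ε 0<ε = bounded-lists (K * K) K , graphic-unless-listed
  where
  K : ℕ
  K = ℚ.↧ₙ ε
  graphic-unless-listed : ∀ d → InRegion (φ ε) d → d ∉ bounded-lists (K * K) K → Graphic d
  graphic-unless-listed d (_ , S , c₁ , _ , _ , _ , (2≤c₂ , _ , c₁²≤) , (_ , _ , bounds , ∑d≡S , 2∣S)) d∉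
    with c₁ * suc c₁ ≤? S
  ... | yes c₁[c₁+1]≤S = c[c+1]≤sum⇒graphic d c₁ (subst (2 ∣_) (sym ∑d≡S) 2∣S) (All.map proj₁ bounds)
                           (subst (c₁ * suc c₁ ≤_) (sym ∑d≡S) c₁[c₁+1]≤S)
  ... | no  small = ⊥-elim (d∉ (small-sum⇒∈-bounded-lists {K = K} d (≤-trans (s≤s z≤n) 2≤c₂) bounds ∑d≡S
                      (small-sum⇒c<K z<s (ℚ-bound⇒ℕ-bound 0<ε (c₁ * c₁) S c₁²≤) (≰⇒> small)) (≰⇒> small)))
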